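{- Let $\lambda,\mu$ be partitions. If $\mu$ has a $\lambda$-ambiguous square, then $R_{\lambda,\mu}=0$.
   Context: Partitions are identified with their (English-convention, left-justified) diagrams, with $\lambda_i$ squares in row $i$. For partitions $\lambda\supseteq\nu$, $\lambda-\nu$ is the skew diagram of squares of $\lambda$ not in $\nu$; it is a horizontal strip if it has at most one square in each column and a vertical strip if it has at most one square in each row. $\mathcal{R}_{\lambda,\mu}$ is the set of partitions $\nu$ such that $\lambda-\nu$ is a vertical strip and $\mu-\nu$ is a horizontal strip, and $R_{\lambda,\mu}=\sum_{\nu\in\mathcal{R}_{\lambda,\mu}}(-1)^{|\lambda|-|\nu|}$ ($|\cdot|$ = number of squares). A $\lambda$-ambiguous square of $\mu$ is a square contained in both $\lambda$ and $\mu$ that is the rightmost square in its row of $\lambda$ and the bottommost square in its column of $\mu$. -}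

module Defs where

open import Data.Nat using (ℕ; zero; suc; _+_; _∸_; _<_; _≤_; _≥_)
open import Data.Nat.Properties using ()
open import Data.List using (List; []; _∷_)
open import Data.Nat.ListAction using (sum)
open import Data.List.Relation.Unary.All using (All)
open import Data.List.Relation.Unary.Linked using (Linked)
open import Data.Integer using (ℤ; +_; -_)
open import Data.Integer as ℤ using ()
open import Data.Product using (_×_)
open import Relation.Nullary using (¬_)
open import Relation.Binary.PropositionalEquality using (_≡_)

IsPartition : List ℕ → Set
IsPartition l = Linked _≥_ l × All (0 <_) l

row : List ℕ → ℕ → ℕ
row []       _       = 0
row (x ∷ _)  zero    = x
row (_ ∷ xs) (suc i) = row xs i

-- Square (i , j) (row i, column j, both 0-indexed) lies in the diagram.
InDiagram : List ℕ → ℕ → ℕ → Set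
InDiagram l i j = j < row l i

_⊆ᵈ_ : List ℕ → List ℕ → Set
ν ⊆ᵈ l = ∀ i j → InDiagram ν i j → InDiagram l i j

InSkew : List ℕ → List ℕ → ℕ → ℕ → Set
InSkew l ν i j = InDiagram l i j × ¬ InDiagram ν i j

HorizontalStrip : List ℕ → List ℕ → Set
HorizontalStrip l ν =
  ν ⊆ᵈ l × (∀ i i' j → InSkew l ν i j → InSkew l ν i' j → i ≡ i')

VerticalStrip : List ℕ → List ℕ → Set
VerticalStrip l ν =
  ν ⊆ᵈ l × (∀ i j j' → InSkew l ν i j → InSkew l ν i j' → j ≡ j')

InR : List ℕ → List ℕ → List ℕ → Set
InR l m ν = IsPartition ν × VerticalStrip l ν × HorizontalStrip m ν

size : List ℕ → ℕ
size = sum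

signℤ : ℕ → ℤ
signℤ zero          = + 1
signℤ (suc zero)    = - (+ 1)
signℤ (suc (suc n)) = signℤ n

-- Σ_{ν ∈ L} (-1)^{|λ| - |ν|}  (truncated subtraction; for ν ∈ R_{λ,μ}
-- we have ν ⊆ λ, so it is the ordinary difference).
signedSum : List ℕ → List (List ℕ) → ℤ
signedSum l []       = + 0
signedSum l (ν ∷ νs) = signℤ (size l ∸ size ν) ℤ.+ signedSum l νs

Ambiguous : List ℕ → List ℕ → ℕ → ℕ → Set
Ambiguous l m i j =
  InDiagram l i j × InDiagram m i j ×
  (suc j ≡ row l i) × ¬ InDiagram m (suc i) j

-- Let (i, j) be the ambiguous square. Every ν ∈ R_{λ,μ} has row i of length j or j + 1: it is at most
-- λ_i = j + 1 since ν ⊆ λ, and a shorter row would give two squares of row i in the vertical strip λ − ν.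
-- Toggling the square (i, j) maps R_{λ,μ} to itself. Adding it yields a partition, as otherwise (i − 1, j)
-- and (i, j) would be two squares of column j in the horizontal strip μ − ν, and it only shrinks λ − ν and
-- μ − ν. Removing it yields a partition since (i + 1, j) ∉ μ ⊇ ν; λ − ν stays a vertical strip because
-- (i, j) ends row i of λ, and μ − ν a horizontal strip because column j of μ has no square below (i, j)
-- while ν contains all of it above. Toggling changes |ν| by one, so it is a sign-reversing involution of
-- R_{λ,μ}: the signed sum S is invariant under the induced permutation yet every term changes sign, so
-- S = −S = 0.
module Submission where

open import Defs
open import Algebra.Bundles using (CommutativeMonoid)
open import Data.Empty using (⊥-elim)
open import Data.Integer as ℤ using (ℤ; +_; -_; +0; +[1+_]; -[1+_])
open import Data.Integer.Properties using (+-0-commutativeMonoid; neg-distrib-+; neg-involutive)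
open import Data.List using (List; []; _∷_; map; foldr)
open import Data.List.Properties using (map-∘; map-cong-local)
open import Data.List.Membership.Propositional using (_∈_)
open import Data.List.Membership.Propositional.Properties using (∈-map⁺; ∈-map⁻)
open import Data.List.Membership.Propositional.Properties.WithK using (unique∧set⇒bag)
open import Data.List.Relation.Binary.BagAndSetEquality using (∼bag⇒↭)
open import Data.List.Relation.Binary.Permutation.Propositional using (_↭_; ↭⇒↭ₛ)
import Data.List.Relation.Binary.Permutation.Propositional.Properties as ↭
open import Data.List.Relation.Binary.Permutation.Setoid.Properties using (foldr-commMonoid)
open import Data.List.Relation.Unary.All as All using (All; []; _∷_)
import Data.List.Relation.Unary.All.Properties as All
open import Data.List.Relation.Unary.Any using (here; there)
open import Data.List.Relation.Unary.Linked as Linked using (Linked; []; [-]; _∷_)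
open import Data.List.Relation.Unary.Unique.Propositional using (Unique; []; _∷_)
open import Data.Nat using (ℕ; zero; suc; pred; _+_; _∸_; _<_; _≤_; _≥_; z≤n; s≤s; _≟_; _<?_)
open import Data.Nat.Properties
  using ( ≤-refl; ≤-trans; ≤-antisym; ≤-pred; n≤1+n; n<1+n; <⇒≤; <⇒≢; <-≤-trans; <-irrefl; <-cmp; ≮⇒≥
        ; +-mono-≤; +-suc; suc-injective)
open import Data.Product using (Σ; _×_; _,_; proj₁; proj₂)
open import Data.Sum using (_⊎_; inj₁; inj₂)
open import Function.Base using (_∘_)
open import Function.Bundles using (_⇔_; mk⇔; Equivalence)
open import Relation.Binary.Definitions using (tri<; tri≈; tri>)
open import Relation.Binary.PropositionalEquality
  using (_≡_; _≢_; refl; sym; trans; cong; subst; subst₂; module ≡-Reasoning)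
open import Relation.Nullary using (¬_; yes; no)

sumℤ : List ℤ → ℤ
sumℤ = foldr ℤ._+_ (+ 0)

sumℤ-↭ : ∀ {xs ys} → xs ↭ ys → sumℤ xs ≡ sumℤ ys
sumℤ-↭ p = foldr-commMonoid ℤ+.setoid ℤ+.isCommutativeMonoid (↭⇒↭ₛ p)
  where module ℤ+ = CommutativeMonoid +-0-commutativeMonoid

sumℤ-map-neg : ∀ xs → sumℤ (map -_ xs) ≡ - sumℤ xs
sumℤ-map-neg []       = refl
sumℤ-map-neg (x ∷ xs) = trans (cong (ℤ._+_ (- x)) (sumℤ-map-neg xs)) (sym (neg-distrib-+ x (sumℤ xs)))

≡-neg⇒≡0 : ∀ {x} → x ≡ - x → x ≡ + 0
≡-neg⇒≡0 {+0}       _ = refl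
≡-neg⇒≡0 {+[1+ _ ]} ()
≡-neg⇒≡0 { -[1+ _ ]} ()

Unique-map⁺-injectiveOn : ∀ {A B : Set} {f : A → B} {xs} → Unique xs →
  (∀ {x y} → x ∈ xs → y ∈ xs → f x ≡ f y → x ≡ y) → Unique (map f xs)
Unique-map⁺-injectiveOn []           _   = []
Unique-map⁺-injectiveOn (x∉xs ∷ xs!) inj =
  All.map⁺ (All.tabulate λ y∈ fx≡fy → All.lookup x∉xs y∈ (inj (here refl) (there y∈) fx≡fy))
  ∷ Unique-map⁺-injectiveOn xs! λ x∈ y∈ → inj (there x∈) (there y∈)

module _ {A : Set} {f : A → A} {xs : List A}
         (f-closed : ∀ {x} → x ∈ xs → f x ∈ xs)
         (f-involutive : ∀ {x} → x ∈ xs → f (f x) ≡ x) where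

  involution-injectiveOn : ∀ {x y} → x ∈ xs → y ∈ xs → f x ≡ f y → x ≡ y
  involution-injectiveOn x∈ y∈ fx≡fy =
    trans (sym (f-involutive x∈)) (trans (cong f fx≡fy) (f-involutive y∈))

  map-involution-↭ : Unique xs → map f xs ↭ xs
  map-involution-↭ xs! =
    ∼bag⇒↭ (unique∧set⇒bag (Unique-map⁺-injectiveOn xs! involution-injectiveOn) xs! (mk⇔ to from))
    where
    to : ∀ {y} → y ∈ map f xs → y ∈ xs
    to y∈ with ∈-map⁻ f y∈
    ... | x , x∈ , refl = f-closed x∈
    from : ∀ {y} → y ∈ xs → y ∈ map f xs
    from y∈ = subst (_∈ map f xs) (f-involutive y∈) (∈-map⁺ f (f-closed y∈))

  sumℤ-sign-reversing-involution : (w : A → ℤ) → Unique xs →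
    (∀ {x} → x ∈ xs → w (f x) ≡ - w x) → sumℤ (map w xs) ≡ + 0
  sumℤ-sign-reversing-involution w xs! w∘f≡-w = ≡-neg⇒≡0 (begin
    sumℤ (map w xs)           ≡⟨ sumℤ-↭ (↭.map⁺ w (map-involution-↭ xs!)) ⟨
    sumℤ (map w (map f xs))   ≡⟨ cong sumℤ (map-∘ xs) ⟨
    sumℤ (map (w ∘ f) xs)     ≡⟨ cong sumℤ (map-cong-local (All.tabulate w∘f≡-w)) ⟩
    sumℤ (map (-_ ∘ w) xs)    ≡⟨ cong sumℤ (map-∘ xs) ⟩
    sumℤ (map -_ (map w xs))  ≡⟨ sumℤ-map-neg (map w xs) ⟩
    - sumℤ (map w xs)         ∎)
    where open ≡-Reasoning

signedSum≡sumℤ : ∀ l L → signedSum l L ≡ sumℤ (map (λ ν → signℤ (size l ∸ size ν)) L)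
signedSum≡sumℤ l []      = refl
signedSum≡sumℤ l (ν ∷ L) = cong (ℤ._+_ (signℤ (size l ∸ size ν))) (signedSum≡sumℤ l L)

signℤ-suc : ∀ n → signℤ n ≡ - signℤ (suc n)
signℤ-suc zero          = refl
signℤ-suc (suc zero)    = refl
signℤ-suc (suc (suc n)) = signℤ-suc n

signℤ-∸-suc : ∀ n m → m < n → signℤ (n ∸ suc m) ≡ - signℤ (n ∸ m)
signℤ-∸-suc (suc n) zero    _          = signℤ-suc n
signℤ-∸-suc (suc n) (suc m) (s≤s m<n) = signℤ-∸-suc n m m<n

row-head-≤ : ∀ {x} ys → Linked _≥_ (x ∷ ys) → row ys 0 ≤ x
row-head-≤ []      _         = z≤n
row-head-≤ (_ ∷ _) (x≥y ∷ _) = x≥y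

row-antitone : ∀ {ν} → Linked _≥_ ν → ∀ {a b} → a ≤ b → row ν b ≤ row ν a
row-antitone {[]}     _  _                  = z≤n
row-antitone {x ∷ xs} _  {zero}  {zero}  _  = ≤-refl
row-antitone {x ∷ xs} ν↓ {zero}  {suc b} _  =
  ≤-trans (row-antitone (Linked.tail ν↓) z≤n) (row-head-≤ xs ν↓)
row-antitone {x ∷ xs} ν↓ {suc a} {suc b} (s≤s a≤b) = row-antitone (Linked.tail ν↓) a≤b

InDiagram-upward : ∀ {ν} → Linked _≥_ ν → ∀ {a a' b} → a ≤ a' → InDiagram ν a' b → InDiagram ν a b
InDiagram-upward ν↓ a≤a' b<ν = <-≤-trans b<ν (row-antitone ν↓ a≤a')

⊆ᵈ-trans : ∀ ν ν' l → ν ⊆ᵈ ν' → ν' ⊆ᵈ l → ν ⊆ᵈ l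
⊆ᵈ-trans _ _ _ ν⊆ν' ν'⊆l a b = ν'⊆l a b ∘ ν⊆ν' a b

⊆ᵈ⇒row≤ : ∀ ν l → ν ⊆ᵈ l → ∀ k → row ν k ≤ row l k
⊆ᵈ⇒row≤ ν l ν⊆l k with row ν k | ν⊆l k
... | zero  | _  = z≤n
... | suc r | ⊆k = ⊆k r ≤-refl

size-mono : ∀ ν l → (∀ k → row ν k ≤ row l k) → size ν ≤ size l
size-mono []       _        _ = z≤n
size-mono (x ∷ xs) []       h = +-mono-≤ (h 0) (size-mono xs [] (h ∘ suc))
size-mono (x ∷ xs) (y ∷ ys) h = +-mono-≤ (h 0) (size-mono xs ys (h ∘ suc))

InSkew-antitone : ∀ l ν ν' {a b} → ν ⊆ᵈ ν' → InSkew l ν' a b → InSkew l ν a b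
InSkew-antitone _ _ _ ν⊆ν' (ab∈l , ab∉ν') = ab∈l , ab∉ν' ∘ ν⊆ν' _ _

VerticalStrip-shrink : ∀ l ν ν' → ν ⊆ᵈ ν' → ν' ⊆ᵈ l → VerticalStrip l ν → VerticalStrip l ν'
VerticalStrip-shrink l ν ν' ν⊆ν' ν'⊆l (_ , one-per-row) =
  ν'⊆l , λ a b b' p q → one-per-row a b b' (shrink p) (shrink q)
  where
  shrink : ∀ {a b} → InSkew l ν' a b → InSkew l ν a b
  shrink = InSkew-antitone l ν ν' ν⊆ν'

HorizontalStrip-shrink : ∀ m ν ν' → ν ⊆ᵈ ν' → ν' ⊆ᵈ m → HorizontalStrip m ν → HorizontalStrip m ν'
HorizontalStrip-shrink m ν ν' ν⊆ν' ν'⊆m (_ , one-per-column) =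
  ν'⊆m , λ a a' b p q → one-per-column a a' b (shrink p) (shrink q)
  where
  shrink : ∀ {a b} → InSkew m ν' a b → InSkew m ν a b
  shrink = InSkew-antitone m ν ν' ν⊆ν'

∷-IsPartition : ∀ {x ys} → IsPartition ys → 0 < x → row ys 0 ≤ x → IsPartition (x ∷ ys)
∷-IsPartition {ys = []}    _            x>0 _   = [-] , x>0 ∷ []
∷-IsPartition {ys = _ ∷ _} (ys↓ , ys>0) x>0 y≤x = y≤x ∷ ys↓ , x>0 ∷ ys>0

IsPartition-tail : ∀ {x ys} → IsPartition (x ∷ ys) → IsPartition ys
IsPartition-tail (xs↓ , _ ∷ ys>0) = Linked.tail xs↓ , ys>0

IsPartition-head : ∀ {x ys} → IsPartition (x ∷ ys) → 0 < x × row ys 0 ≤ x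
IsPartition-head {ys = ys} (xs↓ , x>0 ∷ _) = x>0 , row-head-≤ ys xs↓

addSquare : ℕ → List ℕ → List ℕ
addSquare zero    []       = 1 ∷ []
addSquare zero    (x ∷ xs) = suc x ∷ xs
addSquare (suc i) []       = 0 ∷ addSquare i []
addSquare (suc i) (x ∷ xs) = x ∷ addSquare i xs

removeSquare : ℕ → List ℕ → List ℕ
removeSquare zero    []              = []
removeSquare zero    (suc zero ∷ []) = []
removeSquare zero    (x ∷ xs)        = pred x ∷ xs
removeSquare (suc i) []              = []
removeSquare (suc i) (x ∷ xs)        = x ∷ removeSquare i xs

AddableRow : ℕ → List ℕ → Set
AddableRow i ν = ∀ {k} → suc k ≡ i → row ν i < row ν k

row-addSquare-same : ∀ i ν → row (addSquare i ν) i ≡ suc (row ν i)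
row-addSquare-same zero    []       = refl
row-addSquare-same zero    (x ∷ xs) = refl
row-addSquare-same (suc i) []       = row-addSquare-same i []
row-addSquare-same (suc i) (x ∷ xs) = row-addSquare-same i xs

row-addSquare-other : ∀ i ν {k} → k ≢ i → row (addSquare i ν) k ≡ row ν k
row-addSquare-other zero    []       {zero}  k≢i = ⊥-elim (k≢i refl)
row-addSquare-other zero    []       {suc k} _   = refl
row-addSquare-other zero    (x ∷ xs) {zero}  k≢i = ⊥-elim (k≢i refl)
row-addSquare-other zero    (x ∷ xs) {suc k} _   = refl
row-addSquare-other (suc i) []       {zero}  _   = refl
row-addSquare-other (suc i) []       {suc k} k≢i = row-addSquare-other i [] (k≢i ∘ cong suc)
row-addSquare-other (suc i) (x ∷ xs) {zero}  _   = refl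
row-addSquare-other (suc i) (x ∷ xs) {suc k} k≢i = row-addSquare-other i xs (k≢i ∘ cong suc)

size-addSquare : ∀ i ν → size (addSquare i ν) ≡ suc (size ν)
size-addSquare zero    []       = refl
size-addSquare zero    (x ∷ xs) = refl
size-addSquare (suc i) []       = size-addSquare i []
size-addSquare (suc i) (x ∷ xs) = trans (cong (_+_ x) (size-addSquare i xs)) (+-suc x (size xs))

addSquare-removeSquare : ∀ i ν → 0 < row ν i → addSquare i (removeSquare i ν) ≡ ν
addSquare-removeSquare zero    (suc zero ∷ [])    _   = refl
addSquare-removeSquare zero    (suc zero ∷ _ ∷ _) _   = refl
addSquare-removeSquare zero    (suc (suc x) ∷ xs) _   = refl
addSquare-removeSquare (suc i) (x ∷ xs)           νi>0 = cong (x ∷_) (addSquare-removeSquare i xs νi>0)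

removeSquare-addSquare : ∀ i ν → All (0 <_) ν → AddableRow i ν → removeSquare i (addSquare i ν) ≡ ν
removeSquare-addSquare zero          []            _          _ = refl
removeSquare-addSquare zero          (suc x ∷ xs)  _          _ = refl
removeSquare-addSquare zero          (zero ∷ xs)   (() ∷ _)   _
removeSquare-addSquare (suc i)       []            _          addable with () ← addable refl
removeSquare-addSquare (suc zero)    (x ∷ xs)      (_ ∷ xs>0) _ =
  cong (x ∷_) (removeSquare-addSquare zero xs xs>0 λ ())
removeSquare-addSquare (suc (suc i)) (x ∷ xs)      (_ ∷ xs>0) addable =
  cong (x ∷_) (removeSquare-addSquare (suc i) xs xs>0 λ { refl → addable refl })

row-removeSquare-≤ : ∀ i ν k → row (removeSquare i ν) k ≤ row ν k
row-removeSquare-≤ zero    []                 _       = z≤n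
row-removeSquare-≤ zero    (suc zero ∷ [])    _       = z≤n
row-removeSquare-≤ zero    (zero ∷ xs)        zero    = z≤n
row-removeSquare-≤ zero    (suc zero ∷ _ ∷ _) zero    = z≤n
row-removeSquare-≤ zero    (suc (suc x) ∷ xs) zero    = n≤1+n (suc x)
row-removeSquare-≤ zero    (zero ∷ xs)        (suc k) = ≤-refl
row-removeSquare-≤ zero    (suc zero ∷ _ ∷ _) (suc k) = ≤-refl
row-removeSquare-≤ zero    (suc (suc x) ∷ xs) (suc k) = ≤-refl
row-removeSquare-≤ (suc i) []                 _       = z≤n
row-removeSquare-≤ (suc i) (x ∷ xs)           zero    = ≤-refl
row-removeSquare-≤ (suc i) (x ∷ xs)           (suc k) = row-removeSquare-≤ i xs k

IsPartition-addSquare : ∀ i ν → IsPartition ν → AddableRow i ν → IsPartition (addSquare i ν)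
IsPartition-addSquare zero          []       _ _ = [-] , s≤s z≤n ∷ []
IsPartition-addSquare zero          (x ∷ xs) ν-part _ =
  ∷-IsPartition (IsPartition-tail ν-part) (s≤s z≤n) (≤-trans (proj₂ (IsPartition-head ν-part)) (n≤1+n x))
IsPartition-addSquare (suc i)       []       _ addable with () ← addable refl
IsPartition-addSquare (suc zero)    (x ∷ xs) ν-part addable =
  ∷-IsPartition (IsPartition-addSquare zero xs (IsPartition-tail ν-part) λ ())
    (proj₁ (IsPartition-head ν-part)) (subst (_≤ x) (sym (row-addSquare-same zero xs)) (addable refl))
IsPartition-addSquare (suc (suc i)) (x ∷ xs) ν-part addable =
  ∷-IsPartition (IsPartition-addSquare (suc i) xs (IsPartition-tail ν-part) λ { refl → addable refl })
    (proj₁ (IsPartition-head ν-part))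
    (subst (_≤ x) (sym (row-addSquare-other (suc i) xs λ ())) (proj₂ (IsPartition-head ν-part)))

IsPartition-removeSquare : ∀ i ν → IsPartition ν → row ν (suc i) < row ν i → IsPartition (removeSquare i ν)
IsPartition-removeSquare zero    (suc zero ∷ [])        _      _ = [] , []
IsPartition-removeSquare zero    (suc zero ∷ y ∷ _)     ν-part (s≤s y≤0)
  with () ← <-≤-trans (proj₁ (IsPartition-head (IsPartition-tail ν-part))) y≤0
IsPartition-removeSquare zero    (suc (suc x) ∷ xs)     ν-part shorter =
  ∷-IsPartition (IsPartition-tail ν-part) (s≤s z≤n) (≤-pred shorter)
IsPartition-removeSquare zero    (zero ∷ xs)            ν-part _ with () ← proj₁ (IsPartition-head ν-part)
IsPartition-removeSquare (suc i) (x ∷ xs)               ν-part shorter =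
  ∷-IsPartition (IsPartition-removeSquare i xs (IsPartition-tail ν-part) shorter)
    (proj₁ (IsPartition-head ν-part))
    (≤-trans (row-removeSquare-≤ i xs 0) (proj₂ (IsPartition-head ν-part)))

⊆ᵈ-addSquare : ∀ i ν → ν ⊆ᵈ addSquare i ν
⊆ᵈ-addSquare i ν a b b<νa with a ≟ i
... | yes refl = subst (b <_) (sym (row-addSquare-same i ν)) (<-≤-trans b<νa (n≤1+n _))
... | no a≢i   = subst (b <_) (sym (row-addSquare-other i ν a≢i)) b<νa

addSquare-new : ∀ i ν {a b} → InSkew (addSquare i ν) ν a b → a ≡ i × b ≡ row ν i
addSquare-new i ν {a} {b} (b<ν⁺a , b≮νa) with a ≟ i
... | yes refl = refl , ≤-antisym (≤-pred (subst (b <_) (row-addSquare-same i ν) b<ν⁺a)) (≮⇒≥ b≮νa)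
... | no a≢i   = ⊥-elim (b≮νa (subst (b <_) (row-addSquare-other i ν a≢i) b<ν⁺a))

addSquare-⊆ᵈ : ∀ i ν l → InDiagram l i (row ν i) → ν ⊆ᵈ l → addSquare i ν ⊆ᵈ l
addSquare-⊆ᵈ i ν l new∈l ν⊆l a b b<ν⁺a with b <? row ν a
... | yes b<νa = ν⊆l a b b<νa
... | no b≮νa with refl , refl ← addSquare-new i ν (b<ν⁺a , b≮νa) = new∈l

addSquare-IsPartition⇒AddableRow : ∀ i ν → IsPartition (addSquare i ν) → AddableRow i ν
addSquare-IsPartition⇒AddableRow i ν (ν⁺↓ , _) {k} refl =
  subst₂ _≤_ (row-addSquare-same i ν) (row-addSquare-other i ν (<⇒≢ (n<1+n k))) (row-antitone ν⁺↓ (n≤1+n k))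

InSkew-addSquare : ∀ i ν x {a b} → InSkew x ν a b → (a ≡ i × b ≡ row ν i) ⊎ InSkew x (addSquare i ν) a b
InSkew-addSquare i ν x {a} {b} (b<xa , b≮νa) with b <? row (addSquare i ν) a
... | yes b<ν⁺a = inj₁ (addSquare-new i ν (b<ν⁺a , b≮νa))
... | no  b≮ν⁺a = inj₂ (b<xa , b≮ν⁺a)

module AmbiguousSquare (l : List ℕ) {m : List ℕ} (m↓ : Linked _≥_ m) {i j : ℕ} (amb : Ambiguous l m i j) where

  private
    ij∈l : InDiagram l i j
    ij∈l = proj₁ amb

    ij∈m : InDiagram m i j
    ij∈m = proj₁ (proj₂ amb)

    row-l-i : suc j ≡ row l i
    row-l-i = proj₁ (proj₂ (proj₂ amb))

    ij-bottom : ¬ InDiagram m (suc i) j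
    ij-bottom = proj₂ (proj₂ (proj₂ amb))

  weight : List ℕ → ℤ
  weight ν = signℤ (size l ∸ size ν)

  toggle : List ℕ → List ℕ
  toggle ν with j <? row ν i
  ... | yes _ = removeSquare i ν
  ... | no  _ = addSquare i ν

  record Addable (ν : List ℕ) : Set where
    field
      lower  : IsPartition ν
      upper  : IsPartition (addSquare i ν)
      row-i  : row ν i ≡ j

  module _ {ν : List ℕ} (ν-addable : Addable ν) where
    open Addable ν-addable

    private
      ν⁺ = addSquare i ν

      row-ν⁺-i : row ν⁺ i ≡ suc j
      row-ν⁺-i = trans (row-addSquare-same i ν) (cong suc row-i)

      ij∈ν⁺ : InDiagram ν⁺ i j
      ij∈ν⁺ = subst (j <_) (sym row-ν⁺-i) ≤-refl

      row-i-filled : ∀ {b} → ¬ InSkew l ν⁺ i b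
      row-i-filled {b} (b<li , b≮ν⁺i) = b≮ν⁺i (subst (b <_) (trans (sym row-l-i) (sym row-ν⁺-i)) b<li)

    InR-addSquare : InR l m ν → InR l m ν⁺
    InR-addSquare (_ , vs@(ν⊆l , _) , hs@(ν⊆m , _)) =
      upper ,
      VerticalStrip-shrink l ν ν⁺ (⊆ᵈ-addSquare i ν)
        (addSquare-⊆ᵈ i ν l (subst (_< row l i) (sym row-i) ij∈l) ν⊆l) vs ,
      HorizontalStrip-shrink m ν ν⁺ (⊆ᵈ-addSquare i ν)
        (addSquare-⊆ᵈ i ν m (subst (_< row m i) (sym row-i) ij∈m) ν⊆m) hs

    private
      column-j-of-skew-m : ∀ {a} → InSkew m ν a j → a ≡ i
      column-j-of-skew-m {a} (j<ma , j≮νa) with <-cmp a i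
      ... | tri≈ _ a≡i _ = a≡i
      ... | tri< a<i _ _ = ⊥-elim (j≮νa (subst (j <_) (row-addSquare-other i ν (<⇒≢ a<i))
                                            (InDiagram-upward (proj₁ upper) (<⇒≤ a<i) ij∈ν⁺)))
      ... | tri> _ _ a>i = ⊥-elim (ij-bottom (InDiagram-upward m↓ a>i j<ma))

    InR-addSquare⁻¹ : InR l m ν⁺ → InR l m ν
    InR-addSquare⁻¹ (_ , (ν⁺⊆l , one-per-row) , (ν⁺⊆m , one-per-column)) =
      lower ,
      (⊆ᵈ-trans ν ν⁺ l (⊆ᵈ-addSquare i ν) ν⁺⊆l , one-per-row') ,
      (⊆ᵈ-trans ν ν⁺ m (⊆ᵈ-addSquare i ν) ν⁺⊆m , one-per-column')
      where
      one-per-row' : ∀ a b b' → InSkew l ν a b → InSkew l ν a b' → b ≡ b'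
      one-per-row' a b b' p q with InSkew-addSquare i ν l p | InSkew-addSquare i ν l q
      ... | inj₁ (_ , b≡)    | inj₁ (_ , b'≡)    = trans b≡ (sym b'≡)
      ... | inj₁ (refl , _)  | inj₂ q⁺           = ⊥-elim (row-i-filled q⁺)
      ... | inj₂ p⁺          | inj₁ (refl , _)   = ⊥-elim (row-i-filled p⁺)
      ... | inj₂ p⁺          | inj₂ q⁺           = one-per-row a b b' p⁺ q⁺

      one-per-column' : ∀ a a' b → InSkew m ν a b → InSkew m ν a' b → a ≡ a'
      one-per-column' a a' b p q with InSkew-addSquare i ν m p | InSkew-addSquare i ν m q
      ... | inj₁ (refl , refl) | _                 = sym (column-j-of-skew-m (subst (InSkew m ν a') row-i q))
      ... | inj₂ _             | inj₁ (refl , refl) = column-j-of-skew-m (subst (InSkew m ν a) row-i p)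
      ... | inj₂ p⁺            | inj₂ q⁺            = one-per-column a a' b p⁺ q⁺

    toggle-lower : toggle ν ≡ ν⁺
    toggle-lower with j <? row ν i
    ... | yes j<νi = ⊥-elim (<-irrefl (sym row-i) j<νi)
    ... | no  _    = refl

    toggle-upper : toggle ν⁺ ≡ ν
    toggle-upper with j <? row ν⁺ i
    ... | yes _    = removeSquare-addSquare i ν (proj₂ lower) (addSquare-IsPartition⇒AddableRow i ν upper)
    ... | no j≮ν⁺i = ⊥-elim (j≮ν⁺i ij∈ν⁺)

    weight-addSquare : InR l m ν⁺ → weight ν⁺ ≡ - weight ν
    weight-addSquare (_ , (ν⁺⊆l , _) , _) = begin
      signℤ (size l ∸ size ν⁺)        ≡⟨ cong (λ s → signℤ (size l ∸ s)) (size-addSquare i ν) ⟩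
      signℤ (size l ∸ suc (size ν))   ≡⟨ signℤ-∸-suc (size l) (size ν) ν<l ⟩
      - signℤ (size l ∸ size ν)       ∎
      where
      open ≡-Reasoning
      ν<l : size ν < size l
      ν<l = subst (_≤ size l) (size-addSquare i ν) (size-mono ν⁺ l (⊆ᵈ⇒row≤ ν⁺ l ν⁺⊆l))

  InR-short-row⇒Addable : ∀ {ν} → InR l m ν → ¬ j < row ν i → Addable ν
  InR-short-row⇒Addable {ν} (ν-part , (_ , one-per-row) , (_ , one-per-column)) j≮νi =
    record { lower = ν-part ; upper = IsPartition-addSquare i ν ν-part addable ; row-i = row-i≡j }
    where
    row-i≡j : row ν i ≡ j
    row-i≡j = one-per-row i (row ν i) j
      (subst (row ν i <_) row-l-i (s≤s (≮⇒≥ j≮νi)) , <-irrefl refl) (ij∈l , j≮νi)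
    addable : AddableRow i ν
    addable {k} refl with j <? row ν k
    ... | yes j<νk = subst (_< row ν k) (sym row-i≡j) j<νk
    ... | no  j≮νk = ⊥-elim (<⇒≢ (n<1+n k)
          (one-per-column k (suc k) j (InDiagram-upward m↓ (n≤1+n k) ij∈m , j≮νk) (ij∈m , j≮νi)))

  InR-full-row⇒Addable : ∀ {ν} → InR l m ν → j < row ν i →
    Addable (removeSquare i ν) × addSquare i (removeSquare i ν) ≡ ν
  InR-full-row⇒Addable {ν} (ν-part , (ν⊆l , _) , (ν⊆m , _)) j<νi =
    record { lower = ν⁻-part ; upper = subst IsPartition (sym ν⁻⁺≡ν) ν-part ; row-i = row-ν⁻-i } , ν⁻⁺≡ν
    where
    ν⁻ = removeSquare i ν
    row-ν-i : row ν i ≡ suc j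
    row-ν-i = ≤-antisym (subst (row ν i ≤_) (sym row-l-i) (⊆ᵈ⇒row≤ ν l ν⊆l i)) j<νi
    ν⁻⁺≡ν : addSquare i ν⁻ ≡ ν
    ν⁻⁺≡ν = addSquare-removeSquare i ν (≤-trans (s≤s z≤n) j<νi)
    ν⁻-part : IsPartition ν⁻
    ν⁻-part = IsPartition-removeSquare i ν ν-part
      (subst (row ν (suc i) <_) (sym row-ν-i) (s≤s (≮⇒≥ (ij-bottom ∘ ν⊆m (suc i) j))))
    row-ν⁻-i : row ν⁻ i ≡ j
    row-ν⁻-i = suc-injective (begin
      suc (row ν⁻ i)          ≡⟨ row-addSquare-same i ν⁻ ⟨
      row (addSquare i ν⁻) i  ≡⟨ cong (λ x → row x i) ν⁻⁺≡ν ⟩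
      row ν i                 ≡⟨ row-ν-i ⟩
      suc j                   ∎)
      where open ≡-Reasoning

  InR-split : ∀ {ν} → InR l m ν → Σ (List ℕ) λ ν⁻ → Addable ν⁻ × (ν ≡ ν⁻ ⊎ ν ≡ addSquare i ν⁻)
  InR-split {ν} ν∈R with j <? row ν i
  ... | no  j≮νi = ν , InR-short-row⇒Addable ν∈R j≮νi , inj₁ refl
  ... | yes j<νi with ν⁻-addable , ν⁻⁺≡ν ← InR-full-row⇒Addable ν∈R j<νi =
    removeSquare i ν , ν⁻-addable , inj₂ (sym ν⁻⁺≡ν)

  toggle-InR : ∀ {ν} → InR l m ν → InR l m (toggle ν)
  toggle-InR ν∈R with InR-split ν∈R
  ... | _ , a , inj₁ refl rewrite toggle-lower a = InR-addSquare a ν∈R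
  ... | _ , a , inj₂ refl rewrite toggle-upper a = InR-addSquare⁻¹ a ν∈R

  toggle-involutive : ∀ {ν} → InR l m ν → toggle (toggle ν) ≡ ν
  toggle-involutive ν∈R with InR-split ν∈R
  ... | _ , a , inj₁ refl rewrite toggle-lower a = toggle-upper a
  ... | _ , a , inj₂ refl rewrite toggle-upper a = toggle-lower a

  toggle-weight : ∀ {ν} → InR l m ν → weight (toggle ν) ≡ - weight ν
  toggle-weight ν∈R with InR-split ν∈R
  ... | _ , a , inj₁ refl rewrite toggle-lower a = weight-addSquare a (InR-addSquare a ν∈R)
  ... | ν⁻ , a , inj₂ refl rewrite toggle-upper a =
    trans (sym (neg-involutive (weight ν⁻))) (cong -_ (sym (weight-addSquare a ν∈R)))

lemma3p2 : (l m : List ℕ) → IsPartition l → IsPartition m →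
    Σ ℕ (λ i → Σ ℕ (λ j → Ambiguous l m i j)) →
    (L : List (List ℕ)) → Unique L → (∀ ν → (ν ∈ L) ⇔ InR l m ν) →
    signedSum l L ≡ + 0
lemma3p2 l m _ (m↓ , _) (i , j , amb) L L! L≡R = begin
  signedSum l L        ≡⟨ signedSum≡sumℤ l L ⟩
  sumℤ (map weight L)  ≡⟨ sumℤ-sign-reversing-involution
                            (InR⇒∈L ∘ toggle-InR ∘ ∈L⇒InR) (toggle-involutive ∘ ∈L⇒InR)
                            weight L! (toggle-weight ∘ ∈L⇒InR) ⟩
  + 0                  ∎
  where
  open ≡-Reasoning
  open AmbiguousSquare l m↓ amb
  ∈L⇒InR : ∀ {ν} → ν ∈ L → InR l m ν
  ∈L⇒InR = Equivalence.to (L≡R _)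
  InR⇒∈L : ∀ {ν} → InR l m ν → ν ∈ L
  InR⇒∈L = Equivalence.from (L≡R _)
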